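{- Let $(g,f)$ be a Riordan array with $g(0)=1$, and for an infinite matrix $M$ and an integer $N\ge1$ let $M_N$ denote its leading principal $N\times N$ submatrix (rows and columns indexed $0,\dots,N-1$). Then for every integer $n\ge2$, $$(g,f)_n=[g,f]_n\,\big([1]\oplus(g,f)_{n-1}\big),$$ where $[1]\oplus(g,f)_{n-1}$ denotes the $n\times n$ block-diagonal matrix $\begin{pmatrix}1&0\\0&(g,f)_{n-1}\end{pmatrix}$.
   Context: $\mathbb{K}$ is $\mathbb{R}$ or $\mathbb{C}$. For $g\in\mathbb{K}[[t]]$ with $g(0)=1$ and $f\in\mathbb{K}[[t]]$ with $f(0)=0\ne f'(0)$, the Riordan array $(g,f)=(d_{n,k})_{n,k\ge0}$ is the infinite lower triangular matrix with $d_{n,k}=[t^n]g(t)f(t)^k$. The quasi-Riordan array $[g,f]$ is the infinite lower triangular matrix whose $0$th column has generating function $g$ and whose $j$th column, for $j\ge1$, has generating function $t^{j-1}f$. -}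

module Defs where

open import Level using (_⊔_)
open import Data.Nat using (ℕ; zero; suc; _∸_; _≤?_)
open import Data.Fin using (Fin; toℕ) renaming (zero to fzero; suc to fsuc)
open import Relation.Nullary using (yes; no)
open import Algebra.Bundles using (CommutativeRing)

module Series {c ℓ} (R : CommutativeRing c ℓ) where
  open CommutativeRing R hiding (zero)

  PowerSeries : Set c
  PowerSeries = ℕ → Carrier

  sumℕ : ℕ → (ℕ → Carrier) → Carrier
  sumℕ zero    a = 0#
  sumℕ (suc n) a = sumℕ n a + a n

  _⋆_ : PowerSeries → PowerSeries → PowerSeries
  (a ⋆ b) n = sumℕ (suc n) (λ i → a i * b (n ∸ i))

  oneS : PowerSeries
  oneS zero    = 1#
  oneS (suc _) = 0#

  powS : PowerSeries → ℕ → PowerSeries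
  powS f zero    = oneS
  powS f (suc k) = f ⋆ powS f k

  -- infinite matrices, indexed by (row, column)
  InfMatrix : Set c
  InfMatrix = ℕ → ℕ → Carrier

  riordan : PowerSeries → PowerSeries → InfMatrix
  riordan g f n k = (g ⋆ powS f k) n

  -- quasi-Riordan array [g,f]: column 0 has g.f. g, column j ≥ 1 has g.f. t^{j-1} f
  quasiRiordan : PowerSeries → PowerSeries → InfMatrix
  quasiRiordan g f n zero = g n
  quasiRiordan g f n (suc j) with j ≤? n
  ... | yes _ = f (n ∸ j)
  ... | no  _ = 0#

  Matrix : ℕ → Set c
  Matrix N = Fin N → Fin N → Carrier

  sumFin : ∀ N → (Fin N → Carrier) → Carrier
  sumFin zero    a = 0#
  sumFin (suc N) a = a fzero + sumFin N (λ i → a (fsuc i))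

  _⊗_ : ∀ {N} → Matrix N → Matrix N → Matrix N
  (A ⊗ B) i k = sumFin _ (λ j → A i j * B j k)

  lead : (N : ℕ) → InfMatrix → Matrix N
  lead N M i j = M (toℕ i) (toℕ j)

  oplus1 : ∀ {N} → Matrix N → Matrix (suc N)
  oplus1 A fzero    fzero    = 1#
  oplus1 A fzero    (fsuc _) = 0#
  oplus1 A (fsuc _) fzero    = 0#
  oplus1 A (fsuc i) (fsuc j) = A i j

  _≋_ : ∀ {N} → Matrix N → Matrix N → Set ℓ
  A ≋ B = ∀ i j → A i j ≈ B i j

-- Column 0 of both sides is g. Column k + 1 of (g,f) is f times column k as power series,
-- and, for i ≤ m, row i of [g,f] with column 0 removed pairs a column vector c₀ … c_{m-1}
-- with exactly the coefficients f_i, f_{i-1}, …, f_1 of that product; the missing term f_0 c_i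
-- vanishes because f_0 = 0. Commutativity and associativity of the Cauchy product give the rest.
module Submission where

open import Defs
open import Data.Nat using (ℕ; suc; _≤_)
open import Relation.Nullary using (¬_)
open import Algebra.Bundles using (CommutativeRing)

open import Data.Nat as ℕ using (zero; _∸_; _<_; _≤′_; _≤?_)
import Data.Nat.Properties as ℕₚ
open import Data.Fin using (Fin; toℕ) renaming (zero to fzero; suc to fsuc)
open import Data.Fin.Properties using (toℕ<n)
open import Data.Empty using (⊥-elim)
open import Data.Sum using (inj₁; inj₂)
open import Relation.Nullary using (yes; no)
open import Relation.Binary.PropositionalEquality as ≡ using (_≡_)
import Algebra.Properties.CommutativeSemigroup as CommutativeSemigroupProperties

module Properties {c ℓ} (R : CommutativeRing c ℓ) where
  open CommutativeRing R hiding (zero)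
  open Series R
  open CommutativeSemigroupProperties +-commutativeSemigroup using (interchange)
  open import Relation.Binary.Reasoning.Setoid setoid

  sumℕ-cong : ∀ n {a b : ℕ → Carrier} → (∀ i → i < n → a i ≈ b i) → sumℕ n a ≈ sumℕ n b
  sumℕ-cong zero    a≈b = refl
  sumℕ-cong (suc n) a≈b =
    +-cong (sumℕ-cong n (λ i i<n → a≈b i (ℕₚ.m<n⇒m<1+n i<n))) (a≈b n ℕₚ.≤-refl)

  sumℕ-zero : ∀ n {a : ℕ → Carrier} → (∀ i → i < n → a i ≈ 0#) → sumℕ n a ≈ 0#
  sumℕ-zero zero    a≈0 = refl
  sumℕ-zero (suc n) a≈0 =
    trans (+-cong (sumℕ-zero n (λ i i<n → a≈0 i (ℕₚ.m<n⇒m<1+n i<n))) (a≈0 n ℕₚ.≤-refl))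
          (+-identityʳ 0#)

  sumℕ-distrib-+ : ∀ n (a b : ℕ → Carrier) →
                   sumℕ n (λ i → a i + b i) ≈ sumℕ n a + sumℕ n b
  sumℕ-distrib-+ zero    a b = sym (+-identityʳ 0#)
  sumℕ-distrib-+ (suc n) a b = trans (+-congʳ (sumℕ-distrib-+ n a b)) (interchange _ _ _ _)

  *-distribˡ-sumℕ : ∀ n x (a : ℕ → Carrier) → x * sumℕ n a ≈ sumℕ n (λ i → x * a i)
  *-distribˡ-sumℕ zero    x a = zeroʳ x
  *-distribˡ-sumℕ (suc n) x a = trans (distribˡ x _ _) (+-congʳ (*-distribˡ-sumℕ n x a))

  *-distribʳ-sumℕ : ∀ n x (a : ℕ → Carrier) → sumℕ n a * x ≈ sumℕ n (λ i → a i * x)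
  *-distribʳ-sumℕ zero    x a = zeroˡ x
  *-distribʳ-sumℕ (suc n) x a = trans (distribʳ x _ _) (+-congʳ (*-distribʳ-sumℕ n x a))

  sumℕ-head : ∀ n (a : ℕ → Carrier) → sumℕ (suc n) a ≈ a 0 + sumℕ n (λ i → a (suc i))
  sumℕ-head zero    a = trans (+-identityˡ _) (sym (+-identityʳ _))
  sumℕ-head (suc n) a = trans (+-congʳ (sumℕ-head n a)) (+-assoc _ _ _)

  sumℕ-reverse : ∀ n (a : ℕ → Carrier) → sumℕ (suc n) a ≈ sumℕ (suc n) (λ i → a (n ∸ i))
  sumℕ-reverse zero    a = refl
  sumℕ-reverse (suc n) a = begin
    sumℕ (suc n) a + a (suc n)                    ≈⟨ +-comm _ _ ⟩
    a (suc n) + sumℕ (suc n) a                    ≈⟨ +-congˡ (sumℕ-reverse n a) ⟩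
    a (suc n) + sumℕ (suc n) (λ i → a (n ∸ i))    ≈⟨ sumℕ-head (suc n) (λ i → a (suc n ∸ i)) ⟨
    sumℕ (suc (suc n)) (λ i → a (suc n ∸ i))      ∎

  sumℕ-triangle : ∀ n (F : ℕ → ℕ → Carrier) →
    sumℕ n (λ k → sumℕ (suc k) (λ i → F i k)) ≈ sumℕ n (λ i → sumℕ (n ∸ i) (λ j → F i (i ℕ.+ j)))
  sumℕ-triangle zero    F = refl
  sumℕ-triangle (suc n) F = begin
    sumℕ n (λ k → sumℕ (suc k) (λ i → F i k)) + (sumℕ n (λ i → F i n) + F n n)
      ≈⟨ +-congʳ (sumℕ-triangle n F) ⟩
    sumℕ n row + (sumℕ n (λ i → F i n) + F n n)
      ≈⟨ +-assoc _ _ _ ⟨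
    (sumℕ n row + sumℕ n (λ i → F i n)) + F n n
      ≈⟨ +-cong (sumℕ-distrib-+ n _ _) diagonal ⟨
    sumℕ n (λ i → row i + F i n) + sumℕ (suc n ∸ n) (λ j → F n (n ℕ.+ j))
      ≈⟨ +-congʳ (sumℕ-cong n extend-row) ⟩
    sumℕ (suc n) (λ i → sumℕ (suc n ∸ i) (λ j → F i (i ℕ.+ j))) ∎
    where
    row : ℕ → Carrier
    row i = sumℕ (n ∸ i) (λ j → F i (i ℕ.+ j))

    diagonal : sumℕ (suc n ∸ n) (λ j → F n (n ℕ.+ j)) ≈ F n n
    diagonal rewrite ℕₚ.m+n∸n≡m 1 n | ℕₚ.+-identityʳ n = +-identityˡ _

    extend-row : ∀ i → i < n → row i + F i n ≈ sumℕ (suc n ∸ i) (λ j → F i (i ℕ.+ j))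
    extend-row i i<n rewrite ℕₚ.+-∸-assoc 1 (ℕₚ.<⇒≤ i<n) =
      +-congˡ (reflexive (≡.cong (F i) (≡.sym (ℕₚ.m+[n∸m]≡n (ℕₚ.<⇒≤ i<n)))))

  sumℕ-vanishing-tail : ∀ {i m} → i ≤′ m → (a : ℕ → Carrier) → (∀ j → i ≤ j → a j ≈ 0#) →
                        sumℕ m a ≈ sumℕ i a
  sumℕ-vanishing-tail ℕ.≤′-refl       a a≈0 = refl
  sumℕ-vanishing-tail (ℕ.≤′-step i≤m) a a≈0 =
    trans (+-cong (sumℕ-vanishing-tail i≤m a a≈0) (a≈0 _ (ℕₚ.≤′⇒≤ i≤m))) (+-identityʳ _)

  sumFin-toℕ : ∀ N (a : ℕ → Carrier) → sumFin N (λ j → a (toℕ j)) ≈ sumℕ N a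
  sumFin-toℕ zero    a = refl
  sumFin-toℕ (suc N) a = trans (+-congˡ (sumFin-toℕ N (λ j → a (suc j)))) (sym (sumℕ-head N a))

  sumFin-zero : ∀ N {a : Fin N → Carrier} → (∀ j → a j ≈ 0#) → sumFin N a ≈ 0#
  sumFin-zero zero    a≈0 = refl
  sumFin-zero (suc N) a≈0 =
    trans (+-cong (a≈0 fzero) (sumFin-zero N (λ j → a≈0 (fsuc j)))) (+-identityʳ 0#)

  ⋆-congˡ : ∀ (a : PowerSeries) {b c : PowerSeries} → (∀ n → b n ≈ c n) →
            ∀ n → (a ⋆ b) n ≈ (a ⋆ c) n
  ⋆-congˡ a b≈c n = sumℕ-cong (suc n) (λ i _ → *-congˡ (b≈c (n ∸ i)))

  ⋆-comm : ∀ (a b : PowerSeries) n → (a ⋆ b) n ≈ (b ⋆ a) n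
  ⋆-comm a b n = trans (sumℕ-reverse n _) (sumℕ-cong (suc n) λ i i≤n →
    trans (*-comm _ _) (*-congʳ (reflexive (≡.cong b (ℕₚ.m∸[m∸n]≡n (ℕₚ.≤-pred i≤n))))))

  ⋆-assoc : ∀ (a b c : PowerSeries) n → ((a ⋆ b) ⋆ c) n ≈ (a ⋆ (b ⋆ c)) n
  ⋆-assoc a b c n = begin
    sumℕ (suc n) (λ k → (a ⋆ b) k * c (n ∸ k))
      ≈⟨ sumℕ-cong (suc n) (λ k _ → *-distribʳ-sumℕ (suc k) _ _) ⟩
    sumℕ (suc n) (λ k → sumℕ (suc k) (λ i → (a i * b (k ∸ i)) * c (n ∸ k)))
      ≈⟨ sumℕ-triangle (suc n) (λ i k → (a i * b (k ∸ i)) * c (n ∸ k)) ⟩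
    sumℕ (suc n) (λ i → sumℕ (suc n ∸ i) (λ j → (a i * b (i ℕ.+ j ∸ i)) * c (n ∸ (i ℕ.+ j))))
      ≈⟨ sumℕ-cong (suc n) factor-out-a ⟩
    sumℕ (suc n) (λ i → a i * (b ⋆ c) (n ∸ i)) ∎
    where
    factor-out-a : ∀ i → i < suc n →
      sumℕ (suc n ∸ i) (λ j → (a i * b (i ℕ.+ j ∸ i)) * c (n ∸ (i ℕ.+ j))) ≈ a i * (b ⋆ c) (n ∸ i)
    factor-out-a i i≤n rewrite ℕₚ.+-∸-assoc 1 (ℕₚ.≤-pred i≤n) = begin
      sumℕ (suc (n ∸ i)) (λ j → (a i * b (i ℕ.+ j ∸ i)) * c (n ∸ (i ℕ.+ j)))
        ≈⟨ sumℕ-cong (suc (n ∸ i)) (λ j _ → trans (*-assoc _ _ _) (*-congˡ (*-cong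
             (reflexive (≡.cong b (ℕₚ.m+n∸m≡n i j)))
             (reflexive (≡.cong c (≡.sym (ℕₚ.∸-+-assoc n i j))))))) ⟩
      sumℕ (suc (n ∸ i)) (λ j → a i * (b j * c (n ∸ i ∸ j)))
        ≈⟨ *-distribˡ-sumℕ (suc (n ∸ i)) (a i) _ ⟨
      a i * (b ⋆ c) (n ∸ i) ∎

  ⋆-identityʳ : ∀ (a : PowerSeries) n → (a ⋆ oneS) n ≈ a n
  ⋆-identityʳ a n = begin
    sumℕ n (λ i → a i * oneS (n ∸ i)) + a n * oneS (n ∸ n)
      ≈⟨ +-cong (sumℕ-zero n off-diagonal) (*-congˡ (reflexive (≡.cong oneS (ℕₚ.n∸n≡0 n)))) ⟩
    0# + a n * 1#  ≈⟨ +-identityˡ _ ⟩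
    a n * 1#       ≈⟨ *-identityʳ _ ⟩
    a n            ∎
    where
    off-diagonal : ∀ i → i < n → a i * oneS (n ∸ i) ≈ 0#
    off-diagonal i i<n with n ∸ i | ℕₚ.m>n⇒m∸n≢0 i<n
    ... | zero  | n∸i≢0 = ⊥-elim (n∸i≢0 ≡.refl)
    ... | suc _ | _     = zeroʳ _

  riordan-zero-column : ∀ g f n → riordan g f n 0 ≈ g n
  riordan-zero-column g f = ⋆-identityʳ g

  riordan-suc-column : ∀ g f k n → riordan g f n (suc k) ≈ (f ⋆ (λ j → riordan g f j k)) n
  riordan-suc-column g f k n = begin
    (g ⋆ (f ⋆ powS f k)) n  ≈⟨ ⋆-congˡ g (⋆-comm f (powS f k)) n ⟩
    (g ⋆ (powS f k ⋆ f)) n  ≈⟨ ⋆-assoc g (powS f k) f n ⟨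
    ((g ⋆ powS f k) ⋆ f) n  ≈⟨ ⋆-comm (g ⋆ powS f k) f n ⟩
    (f ⋆ (g ⋆ powS f k)) n  ∎

  module _ (g f : PowerSeries) where

    quasiRiordan-suc-≤ : ∀ {n j} → j ≤ n → quasiRiordan g f n (suc j) ≡ f (n ∸ j)
    quasiRiordan-suc-≤ {n} {j} j≤n with j ≤? n
    ... | yes _   = ≡.refl
    ... | no  j≰n = ⊥-elim (j≰n j≤n)

    quasiRiordan-suc-≰ : ∀ {n j} → ¬ j ≤ n → quasiRiordan g f n (suc j) ≡ 0#
    quasiRiordan-suc-≰ {n} {j} j≰n with j ≤? n
    ... | yes j≤n = ⊥-elim (j≰n j≤n)
    ... | no  _   = ≡.refl

    quasiRiordan-row : f 0 ≈ 0# → ∀ {i m} → i ≤ m → (c : ℕ → Carrier) →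
                       sumℕ m (λ j → quasiRiordan g f i (suc j) * c j) ≈ (f ⋆ c) i
    quasiRiordan-row f₀≈0 {i} {m} i≤m c = begin
      sumℕ m (λ j → quasiRiordan g f i (suc j) * c j)
        ≈⟨ sumℕ-vanishing-tail (ℕₚ.≤⇒≤′ i≤m) _ beyond-diagonal ⟩
      sumℕ i (λ j → quasiRiordan g f i (suc j) * c j)
        ≈⟨ sumℕ-cong i (λ j j<i → *-congʳ (reflexive (quasiRiordan-suc-≤ (ℕₚ.<⇒≤ j<i)))) ⟩
      sumℕ i (λ j → f (i ∸ j) * c j)
        ≈⟨ +-identityʳ _ ⟨
      sumℕ i (λ j → f (i ∸ j) * c j) + 0#
        ≈⟨ +-congˡ (vanishing-f (ℕₚ.n∸n≡0 i)) ⟨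
      sumℕ (suc i) (λ j → f (i ∸ j) * c j)
        ≈⟨ sumℕ-cong (suc i) (λ j _ → *-comm _ _) ⟩
      (c ⋆ f) i
        ≈⟨ ⋆-comm c f i ⟩
      (f ⋆ c) i ∎
      where
      vanishing-f : ∀ {j} → i ∸ j ≡ 0 → f (i ∸ j) * c j ≈ 0#
      vanishing-f i∸j≡0 = trans (*-congʳ (trans (reflexive (≡.cong f i∸j≡0)) f₀≈0)) (zeroˡ _)

      beyond-diagonal : ∀ j → i ≤ j → quasiRiordan g f i (suc j) * c j ≈ 0#
      beyond-diagonal j i≤j with ℕₚ.m≤n⇒m<n∨m≡n i≤j
      ... | inj₁ i<j    = trans (*-congʳ (reflexive (quasiRiordan-suc-≰ (ℕₚ.<⇒≱ i<j)))) (zeroˡ _)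
      ... | inj₂ ≡.refl = trans (*-congʳ (reflexive (quasiRiordan-suc-≤ {i} ℕₚ.≤-refl)))
                                (vanishing-f (ℕₚ.n∸n≡0 i))

  ⊗-oplus1-zero : ∀ {N} (M : Matrix (suc N)) (A : Matrix N) i → (M ⊗ oplus1 A) i fzero ≈ M i fzero
  ⊗-oplus1-zero {N} M A i = begin
    M i fzero * 1# + sumFin N (λ j → M i (fsuc j) * 0#)
      ≈⟨ +-cong (*-identityʳ _) (sumFin-zero N (λ _ → zeroʳ _)) ⟩
    M i fzero + 0#
      ≈⟨ +-identityʳ _ ⟩
    M i fzero ∎

  ⊗-oplus1-suc : ∀ {N} (M : Matrix (suc N)) (A : Matrix N) i k →
                 (M ⊗ oplus1 A) i (fsuc k) ≈ sumFin N (λ j → M i (fsuc j) * A j k)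
  ⊗-oplus1-suc M A i k = trans (+-congʳ (zeroʳ _)) (+-identityˡ _)

corollary2p5 : ∀ {c ℓ} (R : CommutativeRing c ℓ) →
    let open CommutativeRing R in
    let open Series R in
    (g f : PowerSeries) → g 0 ≈ 1# → f 0 ≈ 0# → ¬ (f 1 ≈ 0#) →
    (m : ℕ) → 1 ≤ m →
    lead (suc m) (riordan g f) ≋ (lead (suc m) (quasiRiordan g f) ⊗ oplus1 (lead m (riordan g f)))
corollary2p5 R g f _ f₀≈0 _ m _ = entrywise
  where
  open CommutativeRing R
  open Series R
  open Properties R
  open import Relation.Binary.Reasoning.Setoid setoid

  D Q : InfMatrix
  D = riordan g f
  Q = quasiRiordan g f

  entrywise : lead (suc m) D ≋ (lead (suc m) Q ⊗ oplus1 (lead m D))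
  entrywise i fzero    =
    trans (riordan-zero-column g f (toℕ i)) (sym (⊗-oplus1-zero (lead (suc m) Q) (lead m D) i))
  entrywise i (fsuc k) = begin
    D (toℕ i) (suc (toℕ k))
      ≈⟨ riordan-suc-column g f (toℕ k) (toℕ i) ⟩
    (f ⋆ (λ j → D j (toℕ k))) (toℕ i)
      ≈⟨ quasiRiordan-row g f f₀≈0 (ℕₚ.≤-pred (toℕ<n i)) _ ⟨
    sumℕ m (λ j → Q (toℕ i) (suc j) * D j (toℕ k))
      ≈⟨ sumFin-toℕ m _ ⟨
    sumFin m (λ j → Q (toℕ i) (suc (toℕ j)) * D (toℕ j) (toℕ k))
      ≈⟨ ⊗-oplus1-suc (lead (suc m) Q) (lead m D) i k ⟨
    (lead (suc m) Q ⊗ oplus1 (lead m D)) i (fsuc k) ∎
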